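{- Let $\sigma=(r_1,\dots,r_k)$ be a composition of $n$ and $\mathrm{rev}(\sigma)=(r_k,\dots,r_1)$. For a composition $\tau=(t_1,\dots,t_l)$ of $n$ with partial sums $u_j=t_1+\cdots+t_j$, let $h_i(\tau)$ denote the number of points $(a_1,\dots,a_n)\in\mathbb{N}^n$ satisfying $a_1+\cdots+a_{u_j}\le u_j$ for all $j\in[l]$ and having exactly $i$ nonzero coordinates. Then $h_i(\sigma)=h_i(\mathrm{rev}(\sigma))$ for all $0\le i\le n$.
   Context: $\mathbb{N}=\{0,1,2,\dots\}$; a composition of $n$ is a sequence of positive integers with sum $n$. -}

module Defs where

open import Data.Nat using (ℕ; zero; suc; _+_; _≤_; _<_; _≤?_; _≟_)
open import Data.Nat.ListAction using (sum)
open import Data.List using (List; []; _∷_; length; filter; reverse; map; take; upTo; concatMap)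
open import Data.List.Relation.Unary.All using (All)
open import Data.Vec using (Vec; []; _∷_; toList)
open import Data.Product using (_×_)
open import Relation.Binary.PropositionalEquality using (_≡_)
open import Relation.Nullary using (Dec; ¬_)
open import Relation.Nullary.Decidable using (_×-dec_; ¬?)
open import Data.List.Relation.Unary.All using (all?)

IsComposition : ℕ → List ℕ → Set
IsComposition n σ = All (λ r → 0 < r) σ × sum σ ≡ n

partialSums : List ℕ → List ℕ
partialSums = go 0
  where
  go : ℕ → List ℕ → List ℕ
  go acc []       = []
  go acc (t ∷ ts) = (acc + t) ∷ go (acc + t) ts

prefixSum : ∀ {n} → ℕ → Vec ℕ n → ℕ
prefixSum m a = sum (take m (toList a))

nonzeros : ∀ {n} → Vec ℕ n → ℕ
nonzeros a = length (filter (λ x → ¬? (x ≟ 0)) (toList a))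

Admissible : ∀ {n} → List ℕ → Vec ℕ n → Set
Admissible τ a = All (λ u → prefixSum u a ≤ u) (partialSums τ)

admissible? : ∀ {n} (τ : List ℕ) (a : Vec ℕ n) → Dec (Admissible τ a)
admissible? τ a = all? (λ u → prefixSum u a ≤? u) (partialSums τ)

box : (b m : ℕ) → List (Vec ℕ m)
box b zero    = [] ∷ []
box b (suc m) = concatMap (λ x → map (x ∷_) (box b m)) (upTo (suc b))

-- Admissible points (τ a composition of n)
-- satisfy a_1+⋯+a_n ≤ n, hence lie in {0,…,n}^n, so counting over this box
-- counts all of them.
h : (n : ℕ) → List ℕ → ℕ → ℕ
h n τ i = length (filter (λ a → admissible? τ a ×-dec (nonzeros a ≟ i)) (box n n))

-- A point a ∈ ℕⁿ with a₁ + ⋯ + aₙ ≤ n is the same thing as the lattice path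
-- N^a₁ E N^a₂ E ⋯ N^aₙ E N^(n − a₁ − ⋯ − aₙ) from (0, 0) to (n, n).  The
-- constraint a₁ + ⋯ + a_u ≤ u says that the path visits a point (x, y) with
-- y ≤ u ≤ x, and the nonzero coordinates of a are the NE corners of the path.
-- Reflecting the path in the antidiagonal, (x, y) ↦ (n − y, n − x), preserves
-- NE corners and turns the constraint at u into the constraint at n − u; since
-- the partial sums of rev(σ) are the numbers n − u for u = 0, u₁, …, u_{k−1},
-- the reflection is an involution exchanging the points counted by h_i(σ)
-- with those counted by h_i(rev(σ)).
module Submission where

open import Defs
open import Data.Nat using (ℕ; zero; suc; _+_; _*_; _∸_; _≤_; z≤n; s≤s)
open import Data.Nat.Properties
open import Data.Nat.ListAction using (sum)
open import Data.Nat.ListAction.Properties using (sum-++; sum-↭)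
open import Data.List
  using (List; []; _∷_; _++_; _∷ʳ_; [_]; length; filter; map; reverse; replicate; take; drop; upTo;
         concatMap; cartesianProductWith)
open import Data.List.Properties
  using (length-map; length-replicate; ∷-injectiveʳ; ++-identityʳ; map-++; map-∘; map-id;
         map-cong; reverse-++; reverse-map; reverse-involutive; unfold-reverse; take-[]; take-all)
open import Data.List.Membership.Propositional using (_∈_)
open import Data.List.Membership.Propositional.Properties
  using (∈-filter⁺; ∈-filter⁻; ∈-map⁺; ∈-map⁻; ∈-upTo⁺; ∈-cartesianProductWith⁺)
open import Data.List.Membership.Propositional.Properties.WithK using (unique∧set⇒bag)
open import Data.List.Relation.Binary.BagAndSetEquality using (∼bag⇒↭)
open import Data.List.Relation.Binary.Permutation.Propositional.Properties using (↭-length; ↭-reverse)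
open import Data.List.Relation.Unary.All as All using (All; []; _∷_)
open import Data.List.Relation.Unary.All.Properties as All using ()
open import Data.List.Relation.Unary.Any using (here; there)
open import Data.List.Relation.Unary.AllPairs using ([]; _∷_)
open import Data.List.Relation.Unary.Unique.Propositional using (Unique)
import Data.List.Relation.Unary.Unique.Propositional.Properties as Unique
open import Data.Vec using (Vec; []; _∷_; toList)
open import Data.Vec.Properties using (length-toList) renaming (∷-injective to Vec-∷-injective)
open import Data.Product using (_×_; _,_; proj₁; proj₂; ∃₂; map₁)
open import Data.Sum using (_⊎_; inj₁; inj₂)
open import Function.Base using (_∘′_)
open import Function.Bundles using (mk⇔)
open import Level using (0ℓ)
open import Relation.Binary.PropositionalEquality
  using (_≡_; refl; sym; trans; cong; cong₂; subst; module ≡-Reasoning)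
open import Relation.Unary using (Pred; Decidable)

open ≡-Reasoning

unique-map-leftInverse : ∀ {A B : Set} {f : A → B} (g : B → A) {xs : List A} →
             All (λ x → g (f x) ≡ x) xs → Unique xs → Unique (map f xs)
unique-map-leftInverse g [] [] = []
unique-map-leftInverse g (gfx≡x ∷ gfxs≡xs) (x∉xs ∷ xs!) =
  All.map⁺ (All.zipWith (λ (gfy≡y , x≢y) fx≡fy → x≢y (trans (sym gfx≡x) (trans (cong g fx≡fy) gfy≡y)))
                        (gfxs≡xs , x∉xs))
  ∷ unique-map-leftInverse g gfxs≡xs xs!

module _ {A : Set} {P Q : Pred A 0ℓ} (P? : Decidable P) (Q? : Decidable Q) where

  length-filter-≡-by-involution :
    ∀ {xs} → Unique xs → (f : A → A) →
    (∀ {x} → x ∈ xs → P x → f x ∈ xs × Q (f x) × f (f x) ≡ x) →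
    (∀ {x} → x ∈ xs → Q x → f x ∈ xs × P (f x) × f (f x) ≡ x) →
    length (filter P? xs) ≡ length (filter Q? xs)
  length-filter-≡-by-involution {xs} xs! f P⇒Q Q⇒P = begin
    length (filter P? xs)         ≡⟨ ↭-length (∼bag⇒↭ (unique∧set⇒bag P! fQ! (mk⇔ into onto))) ⟩
    length (map f (filter Q? xs)) ≡⟨ length-map f (filter Q? xs) ⟩
    length (filter Q? xs)         ∎
    where
    P! : Unique (filter P? xs)
    P! = Unique.filter⁺ P? xs!

    fQ! : Unique (map f (filter Q? xs))
    fQ! = unique-map-leftInverse f (All.tabulate involutive) (Unique.filter⁺ Q? xs!)
      where
      involutive : ∀ {x} → x ∈ filter Q? xs → f (f x) ≡ x
      involutive x∈ = let x∈xs , qx = ∈-filter⁻ Q? x∈ in proj₂ (proj₂ (Q⇒P x∈xs qx))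

    into : ∀ {x} → x ∈ filter P? xs → x ∈ map f (filter Q? xs)
    into x∈ with ∈-filter⁻ P? x∈
    ... | x∈xs , px with P⇒Q x∈xs px
    ... | fx∈xs , qfx , ffx≡x =
      subst (_∈ map f (filter Q? xs)) ffx≡x (∈-map⁺ f (∈-filter⁺ Q? fx∈xs qfx))

    onto : ∀ {y} → y ∈ map f (filter Q? xs) → y ∈ filter P? xs
    onto y∈ with ∈-map⁻ f y∈
    ... | x , x∈ , refl with ∈-filter⁻ Q? x∈
    ... | x∈xs , qx with Q⇒P x∈xs qx
    ... | fx∈xs , pfx , _ = ∈-filter⁺ P? fx∈xs pfx

concatMap-map≡cartesianProductWith : ∀ {A B C : Set} (f : A → B → C) xs ys →
  concatMap (λ x → map (f x) ys) xs ≡ cartesianProductWith f xs ys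
concatMap-map≡cartesianProductWith f []       ys = refl
concatMap-map≡cartesianProductWith f (x ∷ xs) ys =
  cong (map (f x) ys ++_) (concatMap-map≡cartesianProductWith f xs ys)

box-suc : ∀ b m → box b (suc m) ≡ cartesianProductWith _∷_ (upTo (suc b)) (box b m)
box-suc b m = concatMap-map≡cartesianProductWith _∷_ (upTo (suc b)) (box b m)

box-unique : ∀ b m → Unique (box b m)
box-unique b zero    = [] ∷ []
box-unique b (suc m) = subst Unique (sym (box-suc b m))
  (Unique.cartesianProductWith⁺ _∷_ Vec-∷-injective (Unique.upTo⁺ (suc b)) (box-unique b m))

box-complete : ∀ b {m} (v : Vec ℕ m) → sum (toList v) ≤ b → v ∈ box b m
box-complete b []      _  = here refl
box-complete b {suc m} (x ∷ v) Σ≤b = subst (x ∷ v ∈_) (sym (box-suc b m))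
  (∈-cartesianProductWith⁺ _∷_ (∈-upTo⁺ (s≤s (≤-trans (m≤m+n x _) Σ≤b)))
                               (box-complete b v (≤-trans (m≤n+m _ x) Σ≤b)))

-- Lattice paths

data Step : Set where
  north east : Step

Path : Set
Path = List Step

mirror : Step → Step
mirror north = east
mirror east  = north

mirror-involutive : ∀ s → mirror (mirror s) ≡ s
mirror-involutive north = refl
mirror-involutive east  = refl

-- Reflection of a path in the antidiagonal x + y = n.
reflect : Path → Path
reflect w = reverse (map mirror w)

reflect-∷ : ∀ s w → reflect (s ∷ w) ≡ reflect w ∷ʳ mirror s
reflect-∷ s w = unfold-reverse (mirror s) (map mirror w)

reflect-++ : ∀ p q → reflect (p ++ q) ≡ reflect q ++ reflect p
reflect-++ p q = trans (cong reverse (map-++ mirror p q)) (reverse-++ (map mirror p) (map mirror q))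

reflect-involutive : ∀ w → reflect (reflect w) ≡ w
reflect-involutive w = begin
  reverse (map mirror (reverse (map mirror w))) ≡⟨ cong reverse (reverse-map mirror (map mirror w)) ⟩
  reverse (reverse (map mirror (map mirror w))) ≡⟨ reverse-involutive _ ⟩
  map mirror (map mirror w)                     ≡⟨ map-∘ w ⟨
  map (λ s → mirror (mirror s)) w               ≡⟨ map-cong mirror-involutive w ⟩
  map (λ s → s) w                               ≡⟨ map-id w ⟩
  w                                             ∎

same : Step → Step → ℕ
same north north = 1
same east  east  = 1
same _     _     = 0

same-mirror : ∀ s t → same s (mirror t) ≡ same (mirror s) t
same-mirror north north = refl
same-mirror north east  = refl
same-mirror east  north = refl
same-mirror east  east  = refl

count : Step → Path → ℕ
count s []      = 0
count s (t ∷ w) = same s t + count s w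

count-++ : ∀ s p q → count s (p ++ q) ≡ count s p + count s q
count-++ s []      q = refl
count-++ s (t ∷ p) q = trans (cong (same s t +_) (count-++ s p q)) (sym (+-assoc (same s t) _ _))

count-replicate : ∀ s t x → count s (replicate x t) ≡ x * same s t
count-replicate s t zero    = refl
count-replicate s t (suc x) = cong (same s t +_) (count-replicate s t x)

count-reflect : ∀ s w → count s (reflect w) ≡ count (mirror s) w
count-reflect s []      = refl
count-reflect s (t ∷ w) = begin
  count s (reflect (t ∷ w))                   ≡⟨ cong (count s) (reflect-∷ t w) ⟩
  count s (reflect w ++ [ mirror t ])         ≡⟨ count-++ s (reflect w) _ ⟩
  count s (reflect w) + (same s (mirror t) + 0)
    ≡⟨ cong₂ _+_ (count-reflect s w) (trans (+-identityʳ _) (same-mirror s t)) ⟩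
  count (mirror s) w + same (mirror s) t      ≡⟨ +-comm _ (same (mirror s) t) ⟩
  count (mirror s) (t ∷ w)                    ∎

Balanced : ℕ → Path → Set
Balanced n w = count north w ≡ n × count east w ≡ n

reflect-balanced : ∀ {n w} → Balanced n w → Balanced n (reflect w)
reflect-balanced {w = w} (north≡n , east≡n) =
  trans (count-reflect north w) east≡n , trans (count-reflect east w) north≡n

corner : Step → Step → ℕ
corner north east = 1
corner _     _    = 0

corner-mirror : ∀ s t → corner (mirror t) (mirror s) ≡ corner s t
corner-mirror north north = refl
corner-mirror north east  = refl
corner-mirror east  north = refl
corner-mirror east  east  = refl

corners : Path → ℕ
corners (s ∷ t ∷ w) = corner s t + corners (t ∷ w)
corners _           = 0

-- north cannot end a corner and east cannot start one, so these are the
-- neutral defaults for the first and last step of an empty path.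
firstOr : Step → Path → Step
firstOr d []      = d
firstOr d (s ∷ _) = s

lastOr : Step → Path → Step
lastOr d []      = d
lastOr d (s ∷ w) = lastOr s w

lastOr-∷ʳ : ∀ d w s → lastOr d (w ∷ʳ s) ≡ s
lastOr-∷ʳ d []      s = refl
lastOr-∷ʳ d (t ∷ w) s = lastOr-∷ʳ t w s

lastOr-reflect : ∀ w → lastOr east (reflect w) ≡ mirror (firstOr north w)
lastOr-reflect []      = refl
lastOr-reflect (t ∷ w) = trans (cong (lastOr east) (reflect-∷ t w)) (lastOr-∷ʳ east (reflect w) (mirror t))

corners-∷ : ∀ s w → corners (s ∷ w) ≡ corner s (firstOr north w) + corners w
corners-∷ north []      = refl
corners-∷ east  []      = refl
corners-∷ s     (t ∷ w) = refl

corners-∷ʳ : ∀ w s → corners (w ∷ʳ s) ≡ corners w + corner (lastOr east w) s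
corners-∷ʳ []           s = refl
corners-∷ʳ (t ∷ [])     s = +-identityʳ (corner t s)
corners-∷ʳ (t ∷ u ∷ w) s =
  trans (cong (corner t u +_) (corners-∷ʳ (u ∷ w) s)) (sym (+-assoc (corner t u) _ _))

corners-reflect : ∀ w → corners (reflect w) ≡ corners w
corners-reflect []      = refl
corners-reflect (s ∷ w) = begin
  corners (reflect (s ∷ w))                                ≡⟨ cong corners (reflect-∷ s w) ⟩
  corners (reflect w ∷ʳ mirror s)                          ≡⟨ corners-∷ʳ (reflect w) (mirror s) ⟩
  corners (reflect w) + corner (lastOr east (reflect w)) (mirror s)
    ≡⟨ cong₂ _+_ (corners-reflect w) (cong (λ t → corner t (mirror s)) (lastOr-reflect w)) ⟩
  corners w + corner (mirror (firstOr north w)) (mirror s) ≡⟨ cong (corners w +_) (corner-mirror s _) ⟩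
  corners w + corner s (firstOr north w)                   ≡⟨ +-comm (corners w) _ ⟩
  corner s (firstOr north w) + corners w                   ≡⟨ corners-∷ s w ⟨
  corners (s ∷ w)                                          ∎

-- Points of ℕⁿ as lattice paths

path : List ℕ → ℕ → Path
path []       s = replicate s north
path (x ∷ xs) s = replicate x north ++ east ∷ path xs s

count-north-path : ∀ xs s → count north (path xs s) ≡ sum xs + s
count-north-path []       s = trans (count-replicate north north s) (*-identityʳ s)
count-north-path (x ∷ xs) s = begin
  count north (replicate x north ++ east ∷ path xs s)       ≡⟨ count-++ north (replicate x north) _ ⟩
  count north (replicate x north) + count north (path xs s)
    ≡⟨ cong₂ _+_ (trans (count-replicate north north x) (*-identityʳ x)) (count-north-path xs s) ⟩
  x + (sum xs + s)                                          ≡⟨ +-assoc x (sum xs) s ⟨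
  sum (x ∷ xs) + s                                          ∎

count-east-path : ∀ xs s → count east (path xs s) ≡ length xs
count-east-path []       s = trans (count-replicate east north s) (*-zeroʳ s)
count-east-path (x ∷ xs) s =
  trans (count-++ east (replicate x north) _)
        (cong₂ _+_ (trans (count-replicate east north x) (*-zeroʳ x)) (cong suc (count-east-path xs s)))

corners-replicate-north : ∀ s → corners (replicate s north) ≡ 0
corners-replicate-north zero          = refl
corners-replicate-north (suc zero)    = refl
corners-replicate-north (suc (suc s)) = corners-replicate-north (suc s)

corners-run : ∀ x w → corners (replicate (suc x) north ++ east ∷ w) ≡ suc (corners w)
corners-run zero    w = cong suc (corners-∷ east w)
corners-run (suc x) w = corners-run x w

corners-path : ∀ {n} (a : Vec ℕ n) s → corners (path (toList a) s) ≡ nonzeros a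
corners-path []          s = corners-replicate-north s
corners-path (zero ∷ a)  s = trans (corners-∷ east (path (toList a) s)) (corners-path a s)
corners-path (suc x ∷ a) s = trans (corners-run x _) (cong suc (corners-path a s))

suc-head : ∀ {n} → Vec ℕ (suc n) → Vec ℕ (suc n)
suc-head (x ∷ v) = suc x ∷ v

decode : (n : ℕ) → Path → Vec ℕ n × ℕ
decode zero    w           = [] , length w
decode (suc n) []          = map₁ (0 ∷_) (decode n [])
decode (suc n) (east ∷ w)  = map₁ (0 ∷_) (decode n w)
decode (suc n) (north ∷ w) = map₁ suc-head (decode (suc n) w)

decode-run : ∀ {n} x w → decode (suc n) (replicate x north ++ east ∷ w) ≡ map₁ (x ∷_) (decode n w)
decode-run zero    w = refl
decode-run (suc x) w = cong (map₁ suc-head) (decode-run x w)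

decode-path : ∀ {n} (a : Vec ℕ n) s → decode n (path (toList a) s) ≡ (a , s)
decode-path []      s = cong ([] ,_) (length-replicate s)
decode-path (x ∷ a) s = trans (decode-run x _) (cong (map₁ (x ∷_)) (decode-path a s))

replicate-north : ∀ w → count east w ≡ 0 → replicate (length w) north ≡ w
replicate-north []          _ = refl
replicate-north (north ∷ w) e = cong (north ∷_) (replicate-north w e)
replicate-north (east ∷ w)  ()

path-decode : ∀ n w → count east w ≡ n → let (a , s) = decode n w in path (toList a) s ≡ w
path-decode zero    w           e = replicate-north w e
path-decode (suc n) []          ()
path-decode (suc n) (east ∷ w)  e = cong (east ∷_) (path-decode n w (suc-injective e))
path-decode (suc n) (north ∷ w) e with decode (suc n) w | path-decode (suc n) w e
... | x ∷ a , s | path≡w = cong (north ∷_) path≡w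

pathOf : (n : ℕ) → Vec ℕ n → Path
pathOf n a = path (toList a) (n ∸ sum (toList a))

pointOf : (n : ℕ) → Path → Vec ℕ n
pointOf n w = proj₁ (decode n w)

pathOf-balanced : ∀ {n} (a : Vec ℕ n) → sum (toList a) ≤ n → Balanced n (pathOf n a)
pathOf-balanced a Σa≤n =
  trans (count-north-path (toList a) _) (m+[n∸m]≡n Σa≤n) ,
  trans (count-east-path (toList a) _) (length-toList a)

pointOf-pathOf : ∀ {n} (a : Vec ℕ n) → pointOf n (pathOf n a) ≡ a
pointOf-pathOf a = cong proj₁ (decode-path a _)

module _ {n w} (balanced : Balanced n w) where

  private
    b : Vec ℕ n
    b = proj₁ (decode n w)

    t : ℕ
    t = proj₂ (decode n w)

    Σb+t≡n : sum (toList b) + t ≡ n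
    Σb+t≡n = begin
      sum (toList b) + t              ≡⟨ count-north-path (toList b) t ⟨
      count north (path (toList b) t) ≡⟨ cong (count north) (path-decode n w (proj₂ balanced)) ⟩
      count north w                   ≡⟨ proj₁ balanced ⟩
      n                               ∎

  pointOf-bounded : sum (toList (pointOf n w)) ≤ n
  pointOf-bounded = ≤-trans (m≤m+n _ t) (≤-reflexive Σb+t≡n)

  pathOf-pointOf : pathOf n (pointOf n w) ≡ w
  pathOf-pointOf = begin
    path (toList b) (n ∸ sum (toList b))
      ≡⟨ cong (λ m → path (toList b) (m ∸ sum (toList b))) Σb+t≡n ⟨
    path (toList b) (sum (toList b) + t ∸ sum (toList b))
      ≡⟨ cong (path (toList b)) (m+n∸m≡n (sum (toList b)) t) ⟩
    path (toList b) t
      ≡⟨ path-decode n w (proj₂ balanced) ⟩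
    w ∎

reflectPoint : (n : ℕ) → Vec ℕ n → Vec ℕ n
reflectPoint n a = pointOf n (reflect (pathOf n a))

module _ {n} (a : Vec ℕ n) (Σa≤n : sum (toList a) ≤ n) where

  private
    reflected-balanced : Balanced n (reflect (pathOf n a))
    reflected-balanced = reflect-balanced {w = pathOf n a} (pathOf-balanced a Σa≤n)

  reflectPoint-bounded : sum (toList (reflectPoint n a)) ≤ n
  reflectPoint-bounded = pointOf-bounded reflected-balanced

  pathOf-reflectPoint : pathOf n (reflectPoint n a) ≡ reflect (pathOf n a)
  pathOf-reflectPoint = pathOf-pointOf reflected-balanced

  reflectPoint-involutive : reflectPoint n (reflectPoint n a) ≡ a
  reflectPoint-involutive = begin
    pointOf n (reflect (pathOf n (reflectPoint n a))) ≡⟨ cong (pointOf n ∘′ reflect) pathOf-reflectPoint ⟩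
    pointOf n (reflect (reflect (pathOf n a)))        ≡⟨ cong (pointOf n) (reflect-involutive _) ⟩
    pointOf n (pathOf n a)                            ≡⟨ pointOf-pathOf a ⟩
    a                                                 ∎

  nonzeros-reflectPoint : nonzeros (reflectPoint n a) ≡ nonzeros a
  nonzeros-reflectPoint = begin
    nonzeros (reflectPoint n a)          ≡⟨ corners-path (reflectPoint n a) _ ⟨
    corners (pathOf n (reflectPoint n a)) ≡⟨ cong corners pathOf-reflectPoint ⟩
    corners (reflect (pathOf n a))       ≡⟨ corners-reflect (pathOf n a) ⟩
    corners (pathOf n a)                 ≡⟨ corners-path a _ ⟩
    nonzeros a                           ∎

record Visits (w : Path) (x y : ℕ) : Set where
  constructor visits
  field
    before after : Path
    split        : w ≡ before ++ after
    east-steps   : count east before ≡ x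
    north-steps  : count north before ≡ y

count-suffix : ∀ s p q {n} → count s (p ++ q) ≡ n → count s q ≡ n ∸ count s p
count-suffix s p q {n} total = begin
  count s q                         ≡⟨ m+n∸m≡n (count s p) (count s q) ⟨
  count s p + count s q ∸ count s p ≡⟨ cong (_∸ count s p) (trans (sym (count-++ s p q)) total) ⟩
  n ∸ count s p                     ∎

visits-reflect : ∀ {n w x y} → Balanced n w → Visits w x y → Visits (reflect w) (n ∸ y) (n ∸ x)
visits-reflect (north≡n , east≡n) (visits p q refl refl refl) =
  visits (reflect q) (reflect p) (reflect-++ p q)
         (trans (count-reflect east q) (count-suffix north p q north≡n))
         (trans (count-reflect north q) (count-suffix east p q east≡n))

visits-run : ∀ {w u y} x → Visits w u y → Visits (replicate x north ++ east ∷ w) (suc u) (x + y)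
visits-run zero    (visits p q refl refl refl) = visits (east ∷ p) q refl refl refl
visits-run (suc x) v with visits-run x v
... | visits p q split east≡u north≡y =
  visits (north ∷ p) q (cong (north ∷_) split) east≡u (cong suc north≡y)

visits-path : ∀ {u} xs s → u ≤ length xs → Visits (path xs s) u (sum (take u xs))
visits-path {zero}  xs       s _         = visits [] (path xs s) refl refl refl
visits-path {suc u} (x ∷ xs) s (s≤s u≤) = visits-run x (visits-path xs s u≤)

sum-take-suc-head : ∀ k x xs → sum (take k (suc x ∷ xs)) ≤ suc (sum (take k (x ∷ xs)))
sum-take-suc-head zero    x xs = z≤n
sum-take-suc-head (suc k) x xs = ≤-refl

sum-take-mono : ∀ {u k} xs → u ≤ k → sum (take u xs) ≤ sum (take k xs)
sum-take-mono {zero}          xs       _         = z≤n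
sum-take-mono {suc u} {suc k} []       _         = z≤n
sum-take-mono {suc u} {suc k} (x ∷ xs) (s≤s u≤k) = +-monoʳ-≤ x (sum-take-mono xs u≤k)

path-prefix-bound : ∀ xs s p {q} → path xs s ≡ p ++ q → sum (take (count east p) xs) ≤ count north p
path-prefix-bound xs          s []          _  = z≤n
path-prefix-bound []          s (t ∷ p)     _  =
  ≤-trans (≤-reflexive (cong sum (take-[] (count east (t ∷ p))))) z≤n
path-prefix-bound (zero ∷ xs)  s (north ∷ p) ()
path-prefix-bound (zero ∷ xs)  s (east ∷ p)  eq = path-prefix-bound xs s p (∷-injectiveʳ eq)
path-prefix-bound (suc x ∷ xs) s (north ∷ p) eq =
  ≤-trans (sum-take-suc-head (count east p) x xs)
          (s≤s (path-prefix-bound (x ∷ xs) s p (∷-injectiveʳ eq)))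
path-prefix-bound (suc x ∷ xs) s (east ∷ p)  ()

visits-path-bound : ∀ {xs s x y} → Visits (path xs s) x y → sum (take x xs) ≤ y
visits-path-bound (visits p _ split refl refl) = path-prefix-bound _ _ p split

prefixSum-reflectPoint : ∀ {n v} {a : Vec ℕ n} → sum (toList a) ≤ n → v ≤ n →
                         prefixSum v a ≤ v → prefixSum (n ∸ v) (reflectPoint n a) ≤ n ∸ v
prefixSum-reflectPoint {n} {v} {a} Σa≤n v≤n bound =
  ≤-trans (sum-take-mono (toList b) (∸-monoʳ-≤ n bound)) (visits-path-bound visit)
  where
  b : Vec ℕ n
  b = reflectPoint n a

  visit : Visits (pathOf n b) (n ∸ prefixSum v a) (n ∸ v)
  visit = subst (λ w → Visits w (n ∸ prefixSum v a) (n ∸ v)) (sym (pathOf-reflectPoint a Σa≤n))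
    (visits-reflect (pathOf-balanced a Σa≤n)
      (visits-path (toList a) _ (≤-trans v≤n (≤-reflexive (sym (length-toList a))))))

-- Partial sums

-- Defs.partialSums is defined through a local helper that cannot be named;
-- this is that helper.
partialSumsFrom : ℕ → List ℕ → List ℕ
partialSumsFrom acc []       = []
partialSumsFrom acc (t ∷ ts) = (acc + t) ∷ partialSumsFrom (acc + t) ts

drop-partialSums : ∀ acc σ → drop 1 (partialSums (acc ∷ σ)) ≡ partialSumsFrom acc σ
drop-partialSums acc []      = refl
drop-partialSums acc (t ∷ σ) = cong ((acc + t) ∷_) (drop-partialSums (acc + t) σ)

partialSums≡partialSumsFrom : ∀ σ → partialSums σ ≡ partialSumsFrom 0 σ
partialSums≡partialSumsFrom []      = refl
partialSums≡partialSumsFrom (t ∷ σ) = cong (t ∷_) (drop-partialSums t σ)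

IsPrefixSum : List ℕ → ℕ → Set
IsPrefixSum σ u = ∃₂ λ xs ys → σ ≡ xs ++ ys × sum xs ≡ u

∈-partialSumsFrom : ∀ {acc σ u} → u ∈ partialSumsFrom acc σ →
                    ∃₂ λ xs ys → σ ≡ xs ++ ys × acc + sum xs ≡ u
∈-partialSumsFrom {acc} {t ∷ σ} (here refl) = [ t ] , σ , refl , cong (acc +_) (+-identityʳ t)
∈-partialSumsFrom {acc} {t ∷ σ} (there u∈) with ∈-partialSumsFrom u∈
... | xs , ys , refl , refl = t ∷ xs , ys , refl , sym (+-assoc acc t (sum xs))

partialSumsFrom-∋ : ∀ acc x xs ys → acc + sum (x ∷ xs) ∈ partialSumsFrom acc (x ∷ xs ++ ys)
partialSumsFrom-∋ acc x []        ys = here (cong (acc +_) (+-identityʳ x))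
partialSumsFrom-∋ acc x (x′ ∷ xs) ys = there
  (subst (_∈ partialSumsFrom (acc + x) (x′ ∷ xs ++ ys)) (+-assoc acc x _)
         (partialSumsFrom-∋ (acc + x) x′ xs ys))

∈-partialSums⇒IsPrefixSum : ∀ {σ u} → u ∈ partialSums σ → IsPrefixSum σ u
∈-partialSums⇒IsPrefixSum {σ} u∈ =
  ∈-partialSumsFrom (subst (_ ∈_) (partialSums≡partialSumsFrom σ) u∈)

IsPrefixSum⇒≡0⊎∈-partialSums : ∀ {σ u} → IsPrefixSum σ u → u ≡ 0 ⊎ u ∈ partialSums σ
IsPrefixSum⇒≡0⊎∈-partialSums ([]     , _  , _    , refl) = inj₁ refl
IsPrefixSum⇒≡0⊎∈-partialSums (x ∷ xs , ys , refl , refl) =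
  inj₂ (subst (sum (x ∷ xs) ∈_) (sym (partialSums≡partialSumsFrom (x ∷ xs ++ ys)))
              (partialSumsFrom-∋ 0 x xs ys))

IsPrefixSum⇒≤sum : ∀ {σ u} → IsPrefixSum σ u → u ≤ sum σ
IsPrefixSum⇒≤sum (xs , ys , refl , refl) =
  ≤-trans (m≤m+n (sum xs) (sum ys)) (≤-reflexive (sym (sum-++ xs ys)))

sum-reverse : ∀ σ → sum (reverse σ) ≡ sum σ
sum-reverse σ = sum-↭ (↭-reverse σ)

IsPrefixSum-reverse : ∀ {σ u} → IsPrefixSum (reverse σ) u → IsPrefixSum σ (sum σ ∸ u)
IsPrefixSum-reverse {σ} {u} (xs , ys , rσ≡xs++ys , refl) = reverse ys , reverse xs , σ≡ , Σys≡
  where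
  σ≡ : σ ≡ reverse ys ++ reverse xs
  σ≡ = begin
    σ                       ≡⟨ reverse-involutive σ ⟨
    reverse (reverse σ)     ≡⟨ cong reverse rσ≡xs++ys ⟩
    reverse (xs ++ ys)      ≡⟨ reverse-++ xs ys ⟩
    reverse ys ++ reverse xs ∎
  Σys≡ : sum (reverse ys) ≡ sum σ ∸ sum xs
  Σys≡ = begin
    sum (reverse ys)             ≡⟨ sum-reverse ys ⟩
    sum ys                       ≡⟨ m+n∸m≡n (sum xs) (sum ys) ⟨
    sum xs + sum ys ∸ sum xs     ≡⟨ cong (_∸ sum xs) (sum-++ xs ys) ⟨
    sum (xs ++ ys) ∸ sum xs      ≡⟨ cong (λ τ → sum τ ∸ sum xs) rσ≡xs++ys ⟨
    sum (reverse σ) ∸ sum xs     ≡⟨ cong (_∸ sum xs) (sum-reverse σ) ⟩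
    sum σ ∸ sum xs               ∎

admissible⇒prefixSum≤ : ∀ {n σ} {a : Vec ℕ n} → Admissible σ a →
                        ∀ {u} → IsPrefixSum σ u → prefixSum u a ≤ u
admissible⇒prefixSum≤ adm pre with IsPrefixSum⇒≡0⊎∈-partialSums pre
... | inj₁ refl = z≤n
... | inj₂ u∈   = All.lookup adm u∈

prefixSum≤⇒admissible : ∀ {n σ} {a : Vec ℕ n} →
                        (∀ {u} → IsPrefixSum σ u → prefixSum u a ≤ u) → Admissible σ a
prefixSum≤⇒admissible bound = All.tabulate (λ u∈ → bound (∈-partialSums⇒IsPrefixSum u∈))

admissible⇒bounded : ∀ {n σ} {a : Vec ℕ n} → sum σ ≡ n → Admissible σ a → sum (toList a) ≤ n
admissible⇒bounded {n} {σ} {a} Σσ≡n adm =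
  subst (λ xs → sum xs ≤ n) (take-all n (toList a) (≤-reflexive (length-toList a)))
        (admissible⇒prefixSum≤ adm (σ , [] , sym (++-identityʳ σ) , Σσ≡n))

admissible-reflectPoint : ∀ {n σ} {a : Vec ℕ n} → sum σ ≡ n → Admissible σ a →
                          Admissible (reverse σ) (reflectPoint n a)
admissible-reflectPoint {n} {σ} {a} Σσ≡n adm = prefixSum≤⇒admissible bound
  where
  bound : ∀ {u} → IsPrefixSum (reverse σ) u → prefixSum u (reflectPoint n a) ≤ u
  bound {u} pre = subst (λ v → prefixSum v (reflectPoint n a) ≤ v) (m∸[m∸n]≡n u≤n)
    (prefixSum-reflectPoint (admissible⇒bounded Σσ≡n adm) (m∸n≤m n u) bound-at-n∸u)
    where
    u≤n : u ≤ n
    u≤n = ≤-trans (IsPrefixSum⇒≤sum pre) (≤-reflexive (trans (sum-reverse σ) Σσ≡n))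

    bound-at-n∸u : prefixSum (n ∸ u) a ≤ n ∸ u
    bound-at-n∸u =
      admissible⇒prefixSum≤ adm (subst (λ m → IsPrefixSum σ (m ∸ u)) Σσ≡n (IsPrefixSum-reverse pre))

proposition2p5 : (n : ℕ) (σ : List ℕ) → IsComposition n σ →
                 (i : ℕ) → i ≤ n → h n σ i ≡ h n (reverse σ) i
proposition2p5 n σ (_ , Σσ≡n) i _ =
  length-filter-≡-by-involution _ _ (box-unique n n) (reflectPoint n)
    (exchange Σσ≡n (admissible-reflectPoint Σσ≡n))
    (exchange Σrσ≡n (subst (λ τ → Admissible τ _) (reverse-involutive σ)
                       ∘′ admissible-reflectPoint Σrσ≡n))
  where
  Σrσ≡n : sum (reverse σ) ≡ n
  Σrσ≡n = trans (sum-reverse σ) Σσ≡n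

  exchange : ∀ {τ τ′} → sum τ ≡ n →
             (∀ {a} → Admissible τ a → Admissible τ′ (reflectPoint n a)) →
             ∀ {a} → a ∈ box n n → Admissible τ a × nonzeros a ≡ i →
             reflectPoint n a ∈ box n n ×
             (Admissible τ′ (reflectPoint n a) × nonzeros (reflectPoint n a) ≡ i) ×
             reflectPoint n (reflectPoint n a) ≡ a
  exchange Στ≡n transfer {a} _ (adm , nz≡i) =
    box-complete n _ (reflectPoint-bounded a Σa≤n) ,
    (transfer adm , trans (nonzeros-reflectPoint a Σa≤n) nz≡i) ,
    reflectPoint-involutive a Σa≤n
    where
    Σa≤n : sum (toList a) ≤ n
    Σa≤n = admissible⇒bounded Στ≡n adm
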